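{- Let $F$ and $G$ be forests on the vertex set $\mathcal N=\{1,\dots,N\}$, let $T^F$ be a tree of $F$ and $T^G$ a tree of $G$, let $\mathcal C=\mathcal V T^G\setminus\mathcal V T^F$, and let $\mathcal D$ be the set of all vertices $c\in\mathcal C$ such that the maximal walk in $G$ starting at $c$ passes through a vertex of $\mathcal V T^F$. Then the $\mathcal D$-exchange of $F$ by $G$ and the $\mathcal D$-exchange of $G$ by $F$ are forests.
   Context: A forest is a digraph without directed circuits (loops count as circuits) in which every vertex has outdegree $0$ or $1$; its trees are its weakly connected components; $\mathcal V T$ denotes the vertex set of $T$. In a forest, the maximal walk starting at $c$ is the sequence $c=c_1,c_2,\dots$ obtained by repeatedly following the unique outgoing arc until a vertex of outdegree $0$ (the root of the tree containing $c$) is reached. For digraphs $F,G$ on $\mathcal N$ and $\mathcal D\subseteq\mathcal N$, the $\mathcal D$-exchange of $F$ by $G$ is the digraph on $\mathcal N$ whose arcs are the arcs of $F$ with origin outside $\mathcal D$ together with the arcs of $G$ with origin in $\mathcal D$. -}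

module Defs where

open import Level using (0ℓ)
open import Data.Nat using (ℕ)
open import Data.Fin using (Fin)
open import Data.Product using (_×_; ∃)
open import Data.Sum using (_⊎_)
open import Relation.Nullary using (¬_)
open import Relation.Binary.PropositionalEquality using (_≡_)
open import Relation.Binary.Construct.Closure.ReflexiveTransitive using (Star)
open import Relation.Binary.Construct.Closure.Transitive using (TransClosure)
open import Relation.Binary.Construct.Closure.Equivalence using (EqClosure)

Digraph : ℕ → Set₁
Digraph N = Fin N → Fin N → Set

OutdegreeAtMostOne : ∀ {N} → Digraph N → Set
OutdegreeAtMostOne A = ∀ i j k → A i j → A i k → j ≡ k

NoDirectedCircuit : ∀ {N} → Digraph N → Set
NoDirectedCircuit A = ∀ i → ¬ TransClosure A i i

IsForest : ∀ {N} → Digraph N → Set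
IsForest A = OutdegreeAtMostOne A × NoDirectedCircuit A

WeaklyConnected : ∀ {N} → Digraph N → Fin N → Fin N → Set
WeaklyConnected A = EqClosure A

TreeVertices : ∀ {N} → Digraph N → Fin N → Fin N → Set
TreeVertices A r v = WeaklyConnected A r v

-- v lies on the maximal walk in A starting at c (in a forest the maximal walk is
-- the unique arc-following walk, so these are exactly the vertices reachable from c).
OnMaximalWalk : ∀ {N} → Digraph N → Fin N → Fin N → Set
OnMaximalWalk A c v = Star A c v

Exchange : ∀ {N} → Digraph N → Digraph N → (Fin N → Set) → Digraph N
Exchange F G D i j = (¬ D i × F i j) ⊎ (D i × G i j)

-- 𝒞 = 𝒱T^G ∖ 𝒱T^F, with T^F the tree of F containing a, T^G the tree of G containing b.
Cset : ∀ {N} → Digraph N → Digraph N → Fin N → Fin N → Fin N → Set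
Cset F G a b c = TreeVertices G b c × ¬ TreeVertices F a c

Dset : ∀ {N} → Digraph N → Digraph N → Fin N → Fin N → Fin N → Set
Dset F G a b c = Cset F G a b c × ∃ (λ v → OnMaximalWalk G c v × TreeVertices F a v)

-- Both exchanges are checked by one criterion: a circuit of the 𝒟-exchange of X by Y that is
-- not a circuit of X leaves some d ∈ 𝒟 along a Y-arc.  Following it, as long as we stay in 𝒟
-- we keep following Y, so we either close a circuit of Y or fall into a set Q that is disjoint
-- from 𝒟 and that the exchange never leaves.  For the exchange of F by G, Q is 𝒱T^F (a G-walk
-- from d ∈ 𝒟 stays on the walk to 𝒱T^F, hence in 𝒟 until it enters 𝒱T^F); for the exchange of
-- G by F, Q is the complement of 𝒲 = {c ∈ 𝒱T^G | the G-walk from c meets 𝒱T^F} ⊇ 𝒟, which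
-- G-arcs never leave.  Membership in these sets is not decidable, so the argument runs in the
-- double-negation monad.
module Submission where

open import Defs
open import Data.Nat using (ℕ)
open import Data.Fin using (Fin)
open import Data.Product using (_×_; _,_; ∃; ∃₂; proj₁; proj₂)
open import Data.Sum using (_⊎_; inj₁; inj₂; map₂)
open import Data.Empty using (⊥-elim)
open import Relation.Nullary using (¬_; yes; no)
open import Relation.Nullary.Negation using (¬¬-map)
open import Relation.Nullary.Decidable using (¬¬-excluded-middle)
open import Relation.Binary.PropositionalEquality using (_≡_; refl)
open import Relation.Binary.Construct.Closure.ReflexiveTransitive using (Star; ε; _◅_; _◅◅_)
open import Relation.Binary.Construct.Closure.Transitive using (TransClosure; [_]; _∷_; _∷ʳ_)
open import Relation.Binary.Construct.Closure.Symmetric using (fwd; bwd)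

module _ {N : ℕ} where

  private
    variable
      A X Y : Digraph N
      D : Fin N → Set
      i j k r x y v : Fin N

  TransClosure⇒Star : TransClosure A i j → Star A i j
  TransClosure⇒Star [ a ]     = a ◅ ε
  TransClosure⇒Star (a ∷ as) = a ◅ TransClosure⇒Star as

  treeVertices-fwd : TreeVertices A r x → A x y → TreeVertices A r y
  treeVertices-fwd t a = t ◅◅ (fwd a ◅ ε)

  treeVertices-bwd : TreeVertices A r y → A x y → TreeVertices A r x
  treeVertices-bwd t a = t ◅◅ (bwd a ◅ ε)

  star-next : OutdegreeAtMostOne A → Star A x v → A x y → x ≡ v ⊎ Star A y v
  star-next out ε          _  = inj₁ refl
  star-next out (a ◅ as) a′ with out _ _ _ a a′
  ... | refl = inj₂ as

  exchange-outdegreeAtMostOne : OutdegreeAtMostOne X → OutdegreeAtMostOne Y →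
                                OutdegreeAtMostOne (Exchange X Y D)
  exchange-outdegreeAtMostOne outX outY i j k (inj₁ (_ , p)) (inj₁ (_ , q)) = outX i j k p q
  exchange-outdegreeAtMostOne outX outY i j k (inj₁ (¬d , _)) (inj₂ (d , _)) = ⊥-elim (¬d d)
  exchange-outdegreeAtMostOne outX outY i j k (inj₂ (d , _)) (inj₁ (¬d , _)) = ⊥-elim (¬d d)
  exchange-outdegreeAtMostOne outX outY i j k (inj₂ (_ , p)) (inj₂ (_ , q)) = outY i j k p q

  exchange-path-split : TransClosure (Exchange X Y D) i j →
    TransClosure X i j ⊎
    ∃₂ λ k k′ → Star (Exchange X Y D) i k × D k × Y k k′ × Star (Exchange X Y D) k′ j
  exchange-path-split [ inj₁ (_ , a) ]      = inj₁ [ a ]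
  exchange-path-split [ inj₂ (d , a) ]      = inj₂ (_ , _ , ε , d , a , ε)
  exchange-path-split (inj₂ (d , a) ∷ as)   = inj₂ (_ , _ , ε , d , a , TransClosure⇒Star as)
  exchange-path-split (inj₁ (¬d , a) ∷ as) with exchange-path-split as
  ... | inj₁ xs                         = inj₁ (a ∷ xs)
  ... | inj₂ (k , k′ , s , d , a′ , t) = inj₂ (k , k′ , inj₁ (¬d , a) ◅ s , d , a′ , t)

  module _ (X Y : Digraph N) (D Q : Fin N → Set)
           (Q-closed : ∀ {x y} → Q x → Exchange X Y D x y → Q y)
           (D⇒¬Q : ∀ {x} → D x → ¬ Q x)
           (D-Y-next : ∀ {x y} → D x → Y x y → ¬ ¬ (D y ⊎ Q y)) where

    private
      YWalkInD-or-Q : Fin N → Fin N → Set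
      YWalkInD-or-Q k y = TransClosure Y k y × D y ⊎ Q y

      extend : TransClosure Y k y → D y ⊎ Q y → YWalkInD-or-Q k y
      extend ys (inj₁ d) = inj₁ (ys , d)
      extend ys (inj₂ q) = inj₂ q

      start : D k → Y k y → ¬ ¬ YWalkInD-or-Q k y
      start d a = ¬¬-map (extend [ a ]) (D-Y-next d a)

      step : YWalkInD-or-Q k x → Exchange X Y D x y → ¬ ¬ YWalkInD-or-Q k y
      step (inj₂ q)       e                = λ ¬inv → ¬inv (inj₂ (Q-closed q e))
      step (inj₁ (_ , d)) (inj₁ (¬d , _)) = ⊥-elim (¬d d)
      step (inj₁ (p , d)) (inj₂ (_ , a))  = ¬¬-map (extend (p ∷ʳ a)) (D-Y-next d a)

      along : Star (Exchange X Y D) x y → YWalkInD-or-Q k x → ¬ ¬ YWalkInD-or-Q k y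
      along ε        inv ¬inv = ¬inv inv
      along (e ◅ es) inv ¬inv = step inv e (λ inv′ → along es inv′ ¬inv)

    exchange-noDirectedCircuit : NoDirectedCircuit X → NoDirectedCircuit Y →
                                 NoDirectedCircuit (Exchange X Y D)
    exchange-noDirectedCircuit acyclicX acyclicY i c with exchange-path-split c
    ... | inj₁ xs = acyclicX i xs
    ... | inj₂ (k , k′ , s , d , a , t) =
      start d a λ inv → along (t ◅◅ s) inv λ
        { (inj₁ (ys , _)) → acyclicY k ys
        ; (inj₂ q)        → D⇒¬Q d q }

  module _ (F G : Digraph N) (forestF : IsForest F) (forestG : IsForest G) (a b : Fin N) where

    private
      TF TG W : Fin N → Set
      TF = TreeVertices F a
      TG = TreeVertices G b
      W x = TG x × ∃ λ v → OnMaximalWalk G x v × TF v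

      𝒟 : Fin N → Set
      𝒟 = Dset F G a b

      𝒟⇒W : 𝒟 x → W x
      𝒟⇒W ((tg , _) , w) = tg , w

      𝒟⇒¬TF : 𝒟 x → ¬ TF x
      𝒟⇒¬TF ((_ , ¬tf) , _) = ¬tf

      W-fwd : W x → ¬ TF x → G x y → W y
      W-fwd (tg , v , walk , tfv) ¬tf g with star-next (proj₁ forestG) walk g
      ... | inj₁ refl  = ⊥-elim (¬tf tfv)
      ... | inj₂ walk′ = treeVertices-fwd tg g , v , walk′ , tfv

      W-bwd : G x y → W y → W x
      W-bwd g (tg , v , walk , tfv) = treeVertices-bwd tg g , v , g ◅ walk , tfv

      𝒟-or : W x → ¬ ¬ (𝒟 x ⊎ TF x)
      𝒟-or (tg , w) = ¬¬-map (λ { (yes tf) → inj₂ tf ; (no ¬tf) → inj₁ ((tg , ¬tf) , w) })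
                                 ¬¬-excluded-middle

    exchangeFG-noDirectedCircuit : NoDirectedCircuit (Exchange F G 𝒟)
    exchangeFG-noDirectedCircuit =
      exchange-noDirectedCircuit F G 𝒟 (λ x → ¬ ¬ TF x) closed (λ d ¬¬tf → ¬¬tf (𝒟⇒¬TF d)) next
        (proj₂ forestF) (proj₂ forestG)
      where
      closed : ¬ ¬ TF x → Exchange F G 𝒟 x y → ¬ ¬ TF y
      closed ¬¬tf (inj₁ (_ , f)) = ¬¬-map (λ tf → treeVertices-fwd tf f) ¬¬tf
      closed ¬¬tf (inj₂ (d , _)) = ⊥-elim (¬¬tf (𝒟⇒¬TF d))

      next : 𝒟 x → G x y → ¬ ¬ (𝒟 y ⊎ ¬ ¬ TF y)
      next d g = ¬¬-map (map₂ λ tf ¬tf → ¬tf tf) (𝒟-or (W-fwd (𝒟⇒W d) (𝒟⇒¬TF d) g))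

    exchangeGF-noDirectedCircuit : NoDirectedCircuit (Exchange G F 𝒟)
    exchangeGF-noDirectedCircuit =
      exchange-noDirectedCircuit G F 𝒟 (λ x → ¬ W x) closed (λ d ¬w → ¬w (𝒟⇒W d)) next
        (proj₂ forestG) (proj₂ forestF)
      where
      closed : ¬ W x → Exchange G F 𝒟 x y → ¬ W y
      closed ¬w (inj₁ (_ , g)) w = ¬w (W-bwd g w)
      closed ¬w (inj₂ (d , _)) _ = ¬w (𝒟⇒W d)

      next : 𝒟 x → F x y → ¬ ¬ (𝒟 y ⊎ ¬ W y)
      next d f ¬next = ¬next (inj₂ λ w → 𝒟-or w λ
        { (inj₁ d′) → ¬next (inj₁ d′)
        ; (inj₂ tf) → 𝒟⇒¬TF d (treeVertices-bwd tf f) })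

mainTheorem18 : (N : ℕ) (F G : Digraph N) → IsForest F → IsForest G →
    (a b : Fin N) →
    IsForest (Exchange F G (Dset F G a b)) × IsForest (Exchange G F (Dset F G a b))
mainTheorem18 N F G forestF forestG a b =
    (exchange-outdegreeAtMostOne outF outG , exchangeFG-noDirectedCircuit F G forestF forestG a b)
  , (exchange-outdegreeAtMostOne outG outF , exchangeGF-noDirectedCircuit F G forestF forestG a b)
  where
  outF : OutdegreeAtMostOne F
  outF = proj₁ forestF
  outG : OutdegreeAtMostOne G
  outG = proj₁ forestG
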